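{- Let $P$ be a CP term and $\Gamma$ an environment. If $\vdash P:\Gamma$ in CP, then $\vdash [\![P]\!]:\Gamma$ in HCP.
   Context: Session types: $A,B ::= A\otimes B \mid \mathbf{1} \mid A ⅋ B \mid \bot \mid A\oplus B \mid \mathbf{0} \mid A \& B \mid \top$, with duality the involution $(A\otimes B)^\bot = A^\bot ⅋ B^\bot$, $(A ⅋ B)^\bot = A^\bot\otimes B^\bot$, $\mathbf{1}^\bot=\bot$, $\bot^\bot=\mathbf{1}$, $(A\oplus B)^\bot = A^\bot \& B^\bot$, $(A\& B)^\bot = A^\bot\oplus B^\bot$, $\mathbf{0}^\bot=\top$, $\top^\bot=\mathbf{0}$. An environment is a finite list $x_1:A_1,\dots,x_n:A_n$ of pairwise distinct names with types; $\Gamma,\Delta$ requires disjoint names. A hyper-environment is a finite multiset $\Gamma_1\mid\dots\mid\Gamma_n$ of environments (empty: $\varnothing$); names may be shared between its environments. CP terms: $P,Q ::= x\leftrightarrow y \mid \nu x(P\parallel Q)$ (cut; $x$ bound in $P$ and $Q$) $\mid x[y](P\parallel Q)$ (output; $y$ bound in $P$, $x$ continues in $Q$) $\mid x(y).P$ ($y$ bound in $P$) $\mid x[].0$ (halt) $\mid x().P$ (wait) $\mid x\triangleleft\mathrm{inl}.P\mid x\triangleleft\mathrm{inr}.P\mid x\triangleright\{\mathrm{inl}:P;\mathrm{inr}:Q\}\mid x\triangleright\{\}$. CP typing $\vdash P:\Gamma$: (Ax) $\vdash x\leftrightarrow y:x:A,y:A^\bot$; (Cut) from $\vdash P:\Gamma,x:A$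 and $\vdash Q:\Delta,x:A^\bot$ infer $\vdash \nu x(P\parallel Q):\Gamma,\Delta$; ($\otimes$) from $\vdash P:\Gamma,y:A$ and $\vdash Q:\Delta,x:B$ infer $\vdash x[y](P\parallel Q):\Gamma,\Delta,x:A\otimes B$; ($⅋$) from $\vdash P:\Gamma,y:A,x:B$ infer $\vdash x(y).P:\Gamma,x:A⅋B$; ($\mathbf{1}$) $\vdash x[].0:x:\mathbf{1}$; ($\bot$) from $\vdash P:\Gamma$ infer $\vdash x().P:\Gamma,x:\bot$; ($\oplus_1$) from $\vdash P:\Gamma,x:A$ infer $\vdash x\triangleleft\mathrm{inl}.P:\Gamma,x:A\oplus B$; ($\oplus_2$) from $\vdash P:\Gamma,x:B$ infer $\vdash x\triangleleft\mathrm{inr}.P:\Gamma,x:A\oplus B$; ($\&$) from $\vdash P:\Gamma,x:A$ and $\vdash Q:\Gamma,x:B$ infer $\vdash x\triangleright\{\mathrm{inl}:P;\mathrm{inr}:Q\}:\Gamma,x:A\&B$; ($\top$) $\vdash x\triangleright\{\}:\Gamma,x:\top$; no rule for $\mathbf{0}$. HCP terms: $P,Q,R ::= x\leftrightarrow y \mid 0 \mid (\nu x)P$ (binds $x$) $\mid (P \mid Q) \mid x[y].P$ ($y$ bound in $P$) $\mid x(y).P$ ($y$ bound in $P$) $\mid x[].P \mid x().P \mid x\triangleleft \mathrm{inl}.P \mid x\triangleleft\mathrm{inr}.P \mid x\triangleright\{\mathrm{inl}:P;\mathrm{inr}:Q\} \mid x\triangleright\{\}$. HCP typing $\vdash P:\mathcal{G}$: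 (Ax) $\vdash x\leftrightarrow y : x:A, y:A^\bot$. (H-Cut) from $\vdash P:\mathcal{G}\mid \Gamma, x:A \mid \Delta, x:A^\bot$ infer $\vdash (\nu x)P : \mathcal{G}\mid \Gamma,\Delta$. (H-Mix) from $\vdash P:\mathcal{G}$, $\vdash Q:\mathcal{H}$ infer $\vdash (P\mid Q): \mathcal{G}\mid\mathcal{H}$. (H-Mix$_0$) $\vdash 0:\varnothing$. ($\otimes$) from $\vdash P : \mathcal{G}\mid \Gamma, y:A \mid \Delta, x:B$ infer $\vdash x[y].P : \mathcal{G}\mid\Gamma,\Delta,x:A\otimes B$. ($⅋$) from $\vdash P : \mathcal{G}\mid\Gamma, y:A, x:B$ infer $\vdash x(y).P : \mathcal{G}\mid\Gamma, x:A⅋B$. ($\mathbf{1}$) from $\vdash P:\mathcal{G}$ infer $\vdash x[].P : \mathcal{G}\mid x:\mathbf{1}$. ($\bot$) from $\vdash P:\mathcal{G}\mid\Gamma$ infer $\vdash x().P : \mathcal{G}\mid\Gamma,x:\bot$. ($\oplus_1$) from $\vdash P:\mathcal{G}\mid\Gamma,x:A$ infer $\vdash x\triangleleft\mathrm{inl}.P:\mathcal{G}\mid\Gamma,x:A\oplus B$; ($\oplus_2$) analogously with $\mathrm{inr}$ and $x:B$. ($\&$) from $\vdash P:\Gamma,x:A$ and $\vdash Q:\Gamma,x:B$ infer $\vdash x\triangleright\{\mathrm{inl}:P;\mathrm{inr}:Q\}:\Gamma,x:A\&B$. ($\top$) $\vdash x\triangleright\{\}:\Gamma,x:\top$. No rule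 for $\mathbf{0}$. Each logical rule ($\otimes,⅋,\mathbf{1},\bot,\oplus_1,\oplus_2$) has the side condition that $x$ does not occur in $\mathcal{G}$. The translation $[\![\cdot]\!]$ from CP to HCP terms: $[\![x\leftrightarrow y]\!]=x\leftrightarrow y$; $[\![\nu x(P\parallel Q)]\!]=(\nu x)([\![P]\!]\mid[\![Q]\!])$; $[\![x[y](P\parallel Q)]\!]=x[y].([\![P]\!]\mid[\![Q]\!])$; $[\![x(y).P]\!]=x(y).[\![P]\!]$; $[\![x[].0]\!]=x[].0$; $[\![x().P]\!]=x().[\![P]\!]$; $[\![x\triangleleft\mathrm{inl}.P]\!]=x\triangleleft\mathrm{inl}.[\![P]\!]$; $[\![x\triangleleft\mathrm{inr}.P]\!]=x\triangleleft\mathrm{inr}.[\![P]\!]$; $[\![x\triangleright\{\mathrm{inl}:P;\mathrm{inr}:Q\}]\!]=x\triangleright\{\mathrm{inl}:[\![P]\!];\mathrm{inr}:[\![Q]\!]\}$; $[\![x\triangleright\{\}]\!]=x\triangleright\{\}$. -}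

module Defs where

open import Data.Nat using (ℕ)
open import Data.Product using (_×_; _,_; proj₁; Σ)
open import Data.List using (List; []; _∷_; _++_; [_]; map; concatMap)
open import Data.List.Membership.Propositional using (_∈_; _∉_)
open import Data.List.Relation.Unary.Unique.Propositional using (Unique)
open import Data.List.Relation.Binary.Permutation.Propositional using (_↭_)
open import Data.List.Relation.Binary.Pointwise using (Pointwise)
open import Relation.Binary.PropositionalEquality using (_≢_)

Name : Set
Name = ℕ

infixr 6 _⊗_ _⅋_ _⊕_ _&_
data Ty : Set where
  _⊗_ : Ty → Ty → Ty
  𝟏   : Ty
  _⅋_ : Ty → Ty → Ty
  ⊥'  : Ty
  _⊕_ : Ty → Ty → Ty
  𝟎   : Ty
  _&_ : Ty → Ty → Ty
  ⊤'  : Ty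

dual : Ty → Ty
dual (A ⊗ B) = dual A ⅋ dual B
dual 𝟏 = ⊥'
dual (A ⅋ B) = dual A ⊗ dual B
dual ⊥' = 𝟏
dual (A ⊕ B) = dual A & dual B
dual 𝟎 = ⊤'
dual (A & B) = dual A ⊕ dual B
dual ⊤' = 𝟎

Env : Set
Env = List (Name × Ty)

names : Env → List Name
names Γ = map proj₁ Γ

WF : Env → Set
WF Γ = Unique (names Γ)

-- Hyper-environments: lists of environments, G | H = G ++ H, ∅ = []
HEnv : Set
HEnv = List Env

hnames : HEnv → List Name
hnames G = concatMap names G

-- Equivalence of hyper-environments: multiset (outer permutation)
-- with each environment taken up to exchange
_≈H_ : HEnv → HEnv → Set
G ≈H H = Σ HEnv (λ K → Pointwise _↭_ G K × K ↭ H)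

data CP : Set where
  link   : Name → Name → CP
  cut    : Name → CP → CP → CP
  out    : Name → Name → CP → CP → CP       -- x[y](P ∥ Q)
  inp    : Name → Name → CP → CP            -- x(y).P
  halt   : Name → CP
  wait   : Name → CP → CP
  selL   : Name → CP → CP
  selR   : Name → CP → CP
  offer  : Name → CP → CP → CP
  absurd : Name → CP

data ⊢CP_∶_ : CP → Env → Set where
  ax   : ∀ {x y A} → x ≢ y → ⊢CP link x y ∶ ((x , A) ∷ (y , dual A) ∷ [])
  cutR : ∀ {P Q Γ Δ x A} → WF (Γ ++ Δ) →
         ⊢CP P ∶ (Γ ++ [ (x , A) ]) → ⊢CP Q ∶ (Δ ++ [ (x , dual A) ]) →
         ⊢CP cut x P Q ∶ (Γ ++ Δ)
  ⊗R   : ∀ {P Q Γ Δ x y A B} → WF (Γ ++ Δ ++ [ (x , A ⊗ B) ]) →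
         ⊢CP P ∶ (Γ ++ [ (y , A) ]) → ⊢CP Q ∶ (Δ ++ [ (x , B) ]) →
         ⊢CP out x y P Q ∶ (Γ ++ Δ ++ [ (x , A ⊗ B) ])
  ⅋R   : ∀ {P Γ x y A B} →
         ⊢CP P ∶ (Γ ++ (y , A) ∷ (x , B) ∷ []) →
         ⊢CP inp x y P ∶ (Γ ++ [ (x , A ⅋ B) ])
  𝟏R   : ∀ {x} → ⊢CP halt x ∶ [ (x , 𝟏) ]
  ⊥R   : ∀ {P Γ x} → WF (Γ ++ [ (x , ⊥') ]) →
         ⊢CP P ∶ Γ → ⊢CP wait x P ∶ (Γ ++ [ (x , ⊥') ])
  ⊕₁R  : ∀ {P Γ x A B} → ⊢CP P ∶ (Γ ++ [ (x , A) ]) →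
         ⊢CP selL x P ∶ (Γ ++ [ (x , A ⊕ B) ])
  ⊕₂R  : ∀ {P Γ x A B} → ⊢CP P ∶ (Γ ++ [ (x , B) ]) →
         ⊢CP selR x P ∶ (Γ ++ [ (x , A ⊕ B) ])
  &R   : ∀ {P Q Γ x A B} → ⊢CP P ∶ (Γ ++ [ (x , A) ]) → ⊢CP Q ∶ (Γ ++ [ (x , B) ]) →
         ⊢CP offer x P Q ∶ (Γ ++ [ (x , A & B) ])
  ⊤R   : ∀ {Γ x} → WF (Γ ++ [ (x , ⊤') ]) →
         ⊢CP absurd x ∶ (Γ ++ [ (x , ⊤') ])
  exch : ∀ {P Γ Δ} → Γ ↭ Δ → ⊢CP P ∶ Γ → ⊢CP P ∶ Δ

data HCP : Set where
  link   : Name → Name → HCP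
  nil    : HCP
  new    : Name → HCP → HCP
  par    : HCP → HCP → HCP
  out    : Name → Name → HCP → HCP    -- x[y].P
  inp    : Name → Name → HCP → HCP    -- x(y).P
  halt   : Name → HCP → HCP
  wait   : Name → HCP → HCP
  selL   : Name → HCP → HCP
  selR   : Name → HCP → HCP
  offer  : Name → HCP → HCP → HCP
  absurd : Name → HCP

data ⊢H_∶_ : HCP → HEnv → Set where
  ax   : ∀ {x y A} → x ≢ y → ⊢H link x y ∶ [ ((x , A) ∷ (y , dual A) ∷ []) ]
  hcut : ∀ {P G Γ Δ x A} → WF (Γ ++ Δ) →
         ⊢H P ∶ (G ++ (Γ ++ [ (x , A) ]) ∷ (Δ ++ [ (x , dual A) ]) ∷ []) →
         ⊢H new x P ∶ (G ++ [ Γ ++ Δ ])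
  hmix : ∀ {P Q G H} → ⊢H P ∶ G → ⊢H Q ∶ H → ⊢H par P Q ∶ (G ++ H)
  hmix₀ : ⊢H nil ∶ []
  ⊗R   : ∀ {P G Γ Δ x y A B} → x ∉ hnames G → WF (Γ ++ Δ ++ [ (x , A ⊗ B) ]) →
         ⊢H P ∶ (G ++ (Γ ++ [ (y , A) ]) ∷ (Δ ++ [ (x , B) ]) ∷ []) →
         ⊢H out x y P ∶ (G ++ [ Γ ++ Δ ++ [ (x , A ⊗ B) ] ])
  ⅋R   : ∀ {P G Γ x y A B} → x ∉ hnames G →
         ⊢H P ∶ (G ++ [ Γ ++ (y , A) ∷ (x , B) ∷ [] ]) →
         ⊢H inp x y P ∶ (G ++ [ Γ ++ [ (x , A ⅋ B) ] ])
  𝟏R   : ∀ {P G x} → x ∉ hnames G → ⊢H P ∶ G → ⊢H halt x P ∶ (G ++ [ [ (x , 𝟏) ] ])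
  ⊥R   : ∀ {P G Γ x} → x ∉ hnames G → WF (Γ ++ [ (x , ⊥') ]) →
         ⊢H P ∶ (G ++ [ Γ ]) → ⊢H wait x P ∶ (G ++ [ Γ ++ [ (x , ⊥') ] ])
  ⊕₁R  : ∀ {P G Γ x A B} → x ∉ hnames G → ⊢H P ∶ (G ++ [ Γ ++ [ (x , A) ] ]) →
         ⊢H selL x P ∶ (G ++ [ Γ ++ [ (x , A ⊕ B) ] ])
  ⊕₂R  : ∀ {P G Γ x A B} → x ∉ hnames G → ⊢H P ∶ (G ++ [ Γ ++ [ (x , B) ] ]) →
         ⊢H selR x P ∶ (G ++ [ Γ ++ [ (x , A ⊕ B) ] ])
  &R   : ∀ {P Q Γ x A B} → ⊢H P ∶ [ Γ ++ [ (x , A) ] ] → ⊢H Q ∶ [ Γ ++ [ (x , B) ] ] →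
         ⊢H offer x P Q ∶ [ Γ ++ [ (x , A & B) ] ]
  ⊤R   : ∀ {Γ x} → WF (Γ ++ [ (x , ⊤') ]) → ⊢H absurd x ∶ [ Γ ++ [ (x , ⊤') ] ]
  exch : ∀ {P G H} → G ≈H H → ⊢H P ∶ G → ⊢H P ∶ H

⟦_⟧ : CP → HCP
⟦ link x y ⟧ = link x y
⟦ cut x P Q ⟧ = new x (par ⟦ P ⟧ ⟦ Q ⟧)
⟦ out x y P Q ⟧ = out x y (par ⟦ P ⟧ ⟦ Q ⟧)
⟦ inp x y P ⟧ = inp x y ⟦ P ⟧
⟦ halt x ⟧ = halt x nil
⟦ wait x P ⟧ = wait x ⟦ P ⟧
⟦ selL x P ⟧ = selL x ⟦ P ⟧
⟦ selR x P ⟧ = selR x ⟦ P ⟧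
⟦ offer x P Q ⟧ = offer x ⟦ P ⟧ ⟦ Q ⟧
⟦ absurd x ⟧ = absurd x

module Submission where

-- A CP derivation of ⊢ P : Γ is mapped, rule by rule, to an HCP derivation
-- of ⊢ ⟦ P ⟧ : Γ, a hyper-environment consisting of the single environment Γ.
-- Every HCP rule is used with the context hyper-environment G empty:
--   * the binary CP rules (cut, ⊗) become H-Mix of the two translated
--     premises, followed by the HCP rule joining the two environments;
--   * the side condition "x does not occur in G" is then vacuous
--     (lemma fresh-in-∅);
--   * x[].0 becomes 𝟏 applied to H-Mix₀;
--   * CP exchange on Γ lifts to HCP exchange on the singleton [ Γ ]
--     (lemma singleton-exchange).

open import Defs
open import Data.List using ([_]; []; _∷_)
open import Data.List.Membership.Propositional using (_∉_)
open import Data.List.Membership.Propositional.Properties using (∉[])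
open import Data.List.Relation.Binary.Pointwise using ([]; _∷_)
open import Data.List.Relation.Binary.Permutation.Propositional using (_↭_; ↭-refl)
open import Data.Product using (_,_)

fresh-in-∅ : ∀ {x : Name} → x ∉ hnames []
fresh-in-∅ = ∉[]

singleton-exchange : ∀ {Γ Δ : Env} → Γ ↭ Δ → [ Γ ] ≈H [ Δ ]
singleton-exchange {Δ = Δ} Γ↭Δ = [ Δ ] , (Γ↭Δ ∷ []) , ↭-refl

translate : ∀ {P Γ} → ⊢CP P ∶ Γ → ⊢H ⟦ P ⟧ ∶ [ Γ ]
translate (ax x≢y)       = ax x≢y
translate (cutR wf p q)  = hcut {G = []} wf (hmix (translate p) (translate q))
translate (⊗R wf p q)    = ⊗R {G = []} fresh-in-∅ wf (hmix (translate p) (translate q))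
translate (⅋R p)         = ⅋R {G = []} fresh-in-∅ (translate p)
translate 𝟏R             = 𝟏R {G = []} fresh-in-∅ hmix₀
translate (⊥R wf p)      = ⊥R {G = []} fresh-in-∅ wf (translate p)
translate (⊕₁R p)        = ⊕₁R {G = []} fresh-in-∅ (translate p)
translate (⊕₂R p)        = ⊕₂R {G = []} fresh-in-∅ (translate p)
translate (&R p q)       = &R (translate p) (translate q)
translate (⊤R wf)        = ⊤R wf
translate (exch Γ↭Δ p)   = exch (singleton-exchange Γ↭Δ) (translate p)

theorem28 : (P : CP) (Γ : Env) → ⊢CP P ∶ Γ → ⊢H ⟦ P ⟧ ∶ [ Γ ]
theorem28 _ _ = translate
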